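{- Let $X$ be a finite set of truth values, $\mathbf{2}=\{0,1\}$, and let $\Sigma$ be a set of truth-functional connectives on $X$. Let $\mathcal{L}$ be the set of formulae built from a set $H$ of propositional letters using $\Sigma$, let $\mathcal{L}_M$ be the modal language defined in the context, and let $v:\mathcal{L}\to X$ be a many-valued valuation. Then for every formula $\phi\in\mathcal{L}$ and every $x\in X$, the canonical reduct $\widehat{[x]\phi}\in\mathcal{L}_M$ is satisfied by $v$ (that is, $\mathfrak{F}(v)(\widehat{[x]\phi})=1$) if and only if $x=v(\phi)$.
   Context: Each unary connective $\sim\in\Sigma$ is interpreted as a function $X\to X$, and each binary connective $\odot\in\Sigma$ as a function $X^2\to X$. A many-valued valuation is a map $v:H\to X$ extended homomorphically to $\mathcal{L}$. $\mathcal{L}_M$ is the smallest set such that: $0,1\in\mathcal{L}_M$; $[x]\phi\in\mathcal{L}_M$ for $x\in X$ and $\phi\in\mathcal{L}$; $[x]\Phi\in\mathcal{L}_M$ for $x\in\mathbf{2}$ and $\Phi\in\mathcal{L}_M$; and $\mathcal{L}_M$ is closed under $\wedge$ and $\vee$. The valuation $\mathfrak{F}(v):\mathcal{L}_M\to\mathbf{2}$ is given by: - $0\mapsto0$ and $1\mapsto1$; - $[x]\phi\mapsto1$ iff $v(\phi)=x$; - $[x]\Phi\mapsto1$ iff $\mathfrak{F}(v)(\Phi)=x$, for $x\in\mathbf{2}$; - $\mathfrak{F}(v)$ is homomorphic for $\wedge$ and $\vee$. The canonical reduct $\widehat{[x]\phi}$ is obtained by applying the following rules recursively to $[x]\phi$: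 - $[x](\sim\phi)\mapsto\bigvee_{y\in X,\ x=\sim y}[y]\phi$; - $[x](\phi\odot\psi)\mapsto\bigvee_{y,z\in X,\ x=y\odot z}([y]\phi\wedge[z]\psi)$; - for $x\in\mathbf{2}$ and $\odot\in\{\wedge,\vee\}$: $[x](\Phi\odot\Psi)\mapsto\bigvee_{y,z\in\mathbf{2},\ x=y\odot z}([y]\Phi\wedge[z]\Psi)$. -}

module Defs where

open import Data.Nat using (ℕ)
open import Data.Fin using (Fin; _≟_)
open import Data.Bool using (Bool; true; false; _∧_; _∨_)
open import Data.List using (List; []; _∷_; map; filter; foldr; cartesianProduct; allFin)
open import Data.Product using (_×_; _,_)
open import Relation.Nullary using (does)
open import Relation.Binary.PropositionalEquality using (_≡_)

-- The finite set X of truth values is Fin n (any finite set, up to renaming).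
-- A set Σ of truth-functional connectives: unary symbols U, binary symbols B,
-- each interpreted as a function on X.
record Connectives (n : ℕ) : Set₁ where
  field
    U    : Set
    B    : Set
    unI  : U → Fin n → Fin n
    binI : B → Fin n → Fin n → Fin n

data Form (H U B : Set) : Set where
  var : H → Form H U B
  un  : U → Form H U B → Form H U B
  bin : B → Form H U B → Form H U B → Form H U B

data MForm (n : ℕ) (H U B : Set) : Set where
  𝟘 𝟙   : MForm n H U B
  box   : Fin n → Form H U B → MForm n H U B
  box₂  : Bool → MForm n H U B → MForm n H U B
  _∧ₘ_  : MForm n H U B → MForm n H U B → MForm n H U B
  _∨ₘ_  : MForm n H U B → MForm n H U B → MForm n H U B

module _ {n : ℕ} {H : Set} (C : Connectives n) where
  open Connectives C

  eval : (H → Fin n) → Form H U B → Fin n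
  eval v (var p)     = v p
  eval v (un c φ)    = unI c (eval v φ)
  eval v (bin c φ ψ) = binI c (eval v φ) (eval v ψ)

  boolEq : Bool → Bool → Bool
  boolEq true  true  = true
  boolEq false false = true
  boolEq _     _     = false

  𝔉 : (H → Fin n) → MForm n H U B → Bool
  𝔉 v 𝟘          = false
  𝔉 v 𝟙          = true
  𝔉 v (box x φ)  = does (eval v φ ≟ x)
  𝔉 v (box₂ b Φ) = boolEq (𝔉 v Φ) b
  𝔉 v (Φ ∧ₘ Ψ)   = 𝔉 v Φ ∧ 𝔉 v Ψ
  𝔉 v (Φ ∨ₘ Ψ)   = 𝔉 v Φ ∨ 𝔉 v Ψ

  ⋁ : List (MForm n H U B) → MForm n H U B
  ⋁ = foldr _∨ₘ_ 𝟘

  reduct : Fin n → Form H U B → MForm n H U B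
  reduct x (var p)     = box x (var p)
  reduct x (un c φ)    =
    ⋁ (map (λ y → reduct y φ) (filter (λ y → x ≟ unI c y) (allFin n)))
  reduct x (bin c φ ψ) =
    ⋁ (map (λ { (y , z) → reduct y φ ∧ₘ reduct z ψ })
           (filter (λ { (y , z) → x ≟ binI c y z })
                   (cartesianProduct (allFin n) (allFin n))))

-- The reduct of [x](φ ⊙ ψ) is the disjunction, over all y, z with x = y ⊙ z, of the
-- reducts of [y]φ and [z]ψ.  Because X is finite, this disjunction ranges over every
-- such pair, so it holds iff some such pair satisfies both reducts, i.e. (by induction)
-- iff some y = v(φ), z = v(ψ) has x = y ⊙ z, i.e. iff x = v(φ ⊙ ψ).
module Submission where

open import Defs
open import Data.Nat using (ℕ)
open import Data.Fin using (Fin; _≟_)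
open import Data.Bool using (T; true)
open import Data.Bool.Properties using (T-≡; T-∨; T-∧)
open import Data.List using (List; []; _∷_; map; filter; cartesianProduct; allFin)
open import Data.List.Relation.Unary.Any using (Any; here; there)
open import Data.List.Relation.Unary.Any.Properties using (map⁺; map⁻)
open import Data.List.Membership.Propositional using (_∈_; find; lose)
open import Data.List.Membership.Propositional.Properties
  using (∈-allFin; ∈-cartesianProduct⁺; ∈-filter⁺; ∈-filter⁻)
open import Data.Product using (∃; _×_; _,_; proj₂)
open import Data.Sum using (inj₁; inj₂)
open import Function using (_∘_)
open import Function.Bundles using (_⇔_; mk⇔; Equivalence)
open import Function.Properties.Equivalence using () renaming (trans to ⇔-trans; sym to ⇔-sym)
open import Level using (0ℓ)
open import Relation.Binary.PropositionalEquality using (_≡_; refl; sym; trans; cong; cong₂)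
open import Relation.Nullary using (yes; no)
open import Relation.Unary using (Pred; Decidable)

open Equivalence using (to; from)

module _ {n : ℕ} {H : Set} (C : Connectives n) (v : H → Fin n) where
  open Connectives C

  Sat : MForm n H U B → Set
  Sat Φ = T (𝔉 C v Φ)

  Sat-⋁⇔Any : (Φs : List (MForm n H U B)) → Sat (⋁ C Φs) ⇔ Any Sat Φs
  Sat-⋁⇔Any []       = mk⇔ (λ ()) (λ ())
  Sat-⋁⇔Any (Φ ∷ Φs) = mk⇔ inward outward
    where
    inward : Sat (Φ ∨ₘ ⋁ C Φs) → Any Sat (Φ ∷ Φs)
    inward sat with to (T-∨ {𝔉 C v Φ}) sat
    ... | inj₁ sat-Φ  = here sat-Φ
    ... | inj₂ sat-Φs = there (to (Sat-⋁⇔Any Φs) sat-Φs)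

    outward : Any Sat (Φ ∷ Φs) → Sat (Φ ∨ₘ ⋁ C Φs)
    outward (here sat-Φ)   = from (T-∨ {𝔉 C v Φ}) (inj₁ sat-Φ)
    outward (there sat-Φs) = from (T-∨ {𝔉 C v Φ}) (inj₂ (from (Sat-⋁⇔Any Φs) sat-Φs))

  Sat-⋁-map-filter⇔ : {A : Set} (f : A → MForm n H U B) {P : Pred A 0ℓ} (P? : Decidable P)
    {xs : List A} → (∀ y → y ∈ xs) →
    Sat (⋁ C (map f (filter P? xs))) ⇔ ∃ λ y → P y × Sat (f y)
  Sat-⋁-map-filter⇔ f {P} P? {xs} enum =
    ⇔-trans (Sat-⋁⇔Any (map f (filter P? xs))) (mk⇔ extract insert)
    where
    extract : Any Sat (map f (filter P? xs)) → ∃ λ y → P y × Sat (f y)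
    extract sat with find (map⁻ sat)
    ... | y , y∈ , sat-fy = y , proj₂ (∈-filter⁻ P? {xs = xs} y∈) , sat-fy

    insert : (∃ λ y → P y × Sat (f y)) → Any Sat (map f (filter P? xs))
    insert (y , py , sat-fy) = map⁺ (lose (∈-filter⁺ P? (enum y) py) sat-fy)

  Sat-reduct⇔ : (φ : Form H U B) (x : Fin n) → Sat (reduct C x φ) ⇔ (x ≡ eval C v φ)
  Sat-reduct⇔ (var p) x with v p ≟ x
  ... | yes vp≡x = mk⇔ (λ _ → sym vp≡x) (λ _ → _)
  ... | no  vp≢x = mk⇔ (λ ()) (vp≢x ∘ sym)
  Sat-reduct⇔ (un c φ) x =
    ⇔-trans (Sat-⋁-map-filter⇔ _ _ ∈-allFin) (mk⇔ value witness)
    where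
    value : (∃ λ y → x ≡ unI c y × Sat (reduct C y φ)) → x ≡ unI c (eval C v φ)
    value (y , x≡cy , sat) = trans x≡cy (cong (unI c) (to (Sat-reduct⇔ φ y) sat))

    witness : x ≡ unI c (eval C v φ) → ∃ λ y → x ≡ unI c y × Sat (reduct C y φ)
    witness x≡ = eval C v φ , x≡ , from (Sat-reduct⇔ φ _) refl
  Sat-reduct⇔ (bin c φ ψ) x =
    ⇔-trans (Sat-⋁-map-filter⇔ _ _ (λ (y , z) → ∈-cartesianProduct⁺ (∈-allFin y) (∈-allFin z)))
            (mk⇔ value witness)
    where
    value : (∃ λ ((y , z) : Fin n × Fin n) →
               x ≡ binI c y z × Sat (reduct C y φ ∧ₘ reduct C z ψ)) →
            x ≡ binI c (eval C v φ) (eval C v ψ)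
    value ((y , z) , x≡cyz , sat) with to (T-∧ {𝔉 C v (reduct C y φ)}) sat
    ... | sat-φ , sat-ψ =
      trans x≡cyz (cong₂ (binI c) (to (Sat-reduct⇔ φ y) sat-φ) (to (Sat-reduct⇔ ψ z) sat-ψ))

    witness : x ≡ binI c (eval C v φ) (eval C v ψ) →
              ∃ λ ((y , z) : Fin n × Fin n) →
                x ≡ binI c y z × Sat (reduct C y φ ∧ₘ reduct C z ψ)
    witness x≡ = (eval C v φ , eval C v ψ) , x≡ ,
                 from (T-∧ {𝔉 C v (reduct C (eval C v φ) φ)})
                      (from (Sat-reduct⇔ φ _) refl , from (Sat-reduct⇔ ψ _) refl)

mainTheorem3 : (n : ℕ) (C : Connectives n) (H : Set) (v : H → Fin n)
    (φ : Form H (Connectives.U C) (Connectives.B C)) (x : Fin n) →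
    (𝔉 C v (reduct C x φ) ≡ true) ⇔ (x ≡ eval C v φ)
mainTheorem3 n C H v φ x = ⇔-trans (⇔-sym T-≡) (Sat-reduct⇔ C v φ x)
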